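{- For every $n\ge 3$, the polynomial profile $P_{\textsc{Cis},C_n}(x,y)$ of \textsc{Cis} played on the cycle $C_n$ is the coefficient of $t^n$ in \[\frac{1+xt^2+yt^2}{1-t-xt^2-yt^2},\] and the total number of positions $P_{\textsc{Cis},C_n}(1,1)$ is the coefficient of $t^n$ in \[\frac{1+2t^2}{1-t-2t^2}.\]
   Context: A distance game given by a pair of sets $(S,D)$ of positive integers is played on a finite graph by two players, Left (colouring vertices blue) and Right (colouring vertices red). A position is any assignment to a subset of the vertices of the colours blue or red (other vertices empty) such that no two vertices of the same colour are at graph distance in $S$ and no two vertices of different colours are at graph distance in $D$; no assumption of alternating play is made. \textsc{Cis} is the distance game with $S=D=\{1\}$. The polynomial profile is $P_{G,B}(x,y)=\sum f_{j,l}x^jy^l$ with $f_{j,l}$ the number of positions with $j$ blue and $l$ red vertices. $C_n$ is the cycle with $n$ vertices. -}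

module Defs where

open import Data.Nat using (ℕ; zero; suc; _+_; _%_; _≡ᵇ_)
open import Data.Bool using (Bool; true; false; _∧_; _∨_; not)
open import Data.Fin using (Fin; toℕ)
open import Data.List using (List; []; _∷_; map; concatMap; filter; length; allFin; foldr; upTo)
open import Data.Nat.ListAction using (sum)
open import Data.Vec using (Vec; []; _∷_; lookup; toList)
open import Data.Integer using (ℤ; +_; _-_; _*_)
open import Relation.Nullary.Decidable using (T?)
open import Function using (_∘_)

-- Vertex states: empty, blue (Left), red (Right).
data Colour : Set where
  empty blue red : Colour

coloured : Colour → Bool
coloured empty = false
coloured blue  = true
coloured red   = true

isBlue : Colour → Bool
isBlue blue = true
isBlue _    = false

isRed : Colour → Bool
isRed red = true
isRed _   = false

allColourings : (n : ℕ) → List (Vec Colour n)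
allColourings zero    = [] ∷ []
allColourings (suc n) =
  concatMap (λ c → map (c ∷_) (allColourings n)) (empty ∷ blue ∷ red ∷ [])

adjacent : (n : ℕ) → Fin n → Fin n → Bool
adjacent zero    () _
adjacent (suc m) i j =
  (toℕ j ≡ᵇ ((toℕ i + 1) % suc m)) ∨ (toℕ i ≡ᵇ ((toℕ j + 1) % suc m))

-- Cis: S = D = {1}.  A colouring is a position iff no two vertices at
-- distance 1 (adjacent) are both coloured (same colour forbidden by S,
-- different colours forbidden by D).
allB : ∀ {A : Set} → (A → Bool) → List A → Bool
allB p = foldr (λ a b → p a ∧ b) true

isCisPosition : (n : ℕ) → Vec Colour n → Bool
isCisPosition n c =
  allB (λ i → allB (λ j → not (adjacent n i j ∧ coloured (lookup c i) ∧ coloured (lookup c j)))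
                 (allFin n))
      (allFin n)

countB : ∀ {n} → Vec Colour n → ℕ
countB c = length (filter (T? ∘ isBlue) (toList c))

countR : ∀ {n} → Vec Colour n → ℕ
countR c = length (filter (T? ∘ isRed) (toList c))

-- f_{j,l}: coefficient of x^j y^l in the polynomial profile P_{Cis,C_n}(x,y).
profile : (n j l : ℕ) → ℕ
profile n j l = length (filter (λ c → T? (isCisPosition n c ∧ (countB c ≡ᵇ j) ∧ (countR c ≡ᵇ l)))
                               (allColourings n))

-- P_{Cis,C_n}(1,1) = sum of all coefficients f_{j,l} (they vanish for j,l > n).
profileAt11 : ℕ → ℕ
profileAt11 n = sum (map (λ j → sum (map (λ l → profile n j l) (upTo (suc n)))) (upTo (suc n)))

-- Trivariate formal power series Σ Q n j l t^n x^j y^l over ℤ.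
Series3 : Set
Series3 = ℕ → ℕ → ℕ → ℤ

-- Coefficient of t^n x^j y^l in (1 - t - x t^2 - y t^2) · Q.
denomTimes : Series3 → Series3
denomTimes Q n j l = Q n j l - prev1 n - prevx n j - prevy n l
  where
  prev1 : ℕ → ℤ
  prev1 zero    = + 0
  prev1 (suc m) = Q m j l
  prevx : ℕ → ℕ → ℤ
  prevx (suc (suc m)) (suc j′) = Q m j′ l
  prevx _ _ = + 0
  prevy : ℕ → ℕ → ℤ
  prevy (suc (suc m)) (suc l′) = Q m j l′
  prevy _ _ = + 0

numer : Series3
numer 0 0 0 = + 1
numer 2 1 0 = + 1
numer 2 0 1 = + 1
numer _ _ _ = + 0

-- Q is the power series (1 + xt^2 + yt^2)/(1 - t - xt^2 - yt^2),
-- i.e. Q · (1 - t - xt^2 - yt^2) = 1 + xt^2 + yt^2 (the denominator has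
-- constant term 1, so such Q is unique).
IsQuotient3 : Series3 → Set
IsQuotient3 Q = ∀ n j l → denomTimes Q n j l ≡ numer n j l
  where open import Relation.Binary.PropositionalEquality using (_≡_)

Series1 : Set
Series1 = ℕ → ℤ

-- Coefficient of t^n in (1 - t - 2t^2) · R.
denomTimes1 : Series1 → Series1
denomTimes1 R zero          = R 0
denomTimes1 R (suc zero)    = R 1 - R 0
denomTimes1 R (suc (suc m)) = R (suc (suc m)) - R (suc m) - + 2 * R m

numer1 : Series1
numer1 0 = + 1
numer1 2 = + 2
numer1 _ = + 0

-- R is the power series (1 + 2t^2)/(1 - t - 2t^2).
IsQuotient1 : Series1 → Set
IsQuotient1 R = ∀ n → denomTimes1 R n ≡ numer1 n
  where open import Relation.Binary.PropositionalEquality using (_≡_)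

{-# OPTIONS --safe #-}
-- A position of Cis on a graph is an independent set whose vertices are each coloured blue or
-- red, so its profile is the independence polynomial evaluated at z = x + y. Cutting the cycle
-- C_n at one vertex leaves a path, and path profiles a_k satisfy a_{k+2} = a_{k+1} + z a_k
-- (look at the first vertex: empty, or coloured with an empty neighbour). Hence the cycle
-- profile, a combination of shifted path profiles, satisfies the same recurrence; so do the
-- coefficients of (1 + zt²)/(1 - t - zt²) (the Lucas polynomials L_n(z)), and the values at
-- n = 2, 3 agree. Summing the coefficients gives the value at x = y = 1.
module Submission where

open import Defs
open import Data.Nat using (ℕ; zero; suc; _+_; _*_; _≥_; _<_; _%_; _≡ᵇ_; s≤s)
open import Data.Nat.Properties using (+-identityʳ; +-comm; <⇒≤; m<n⇒m<1+n; n<1+n; ≡ᵇ⇒≡; ≡⇒≡ᵇ)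
open import Data.Nat.DivMod using (m%n<n; n%n≡0; m<n⇒m%n≡m)
open import Data.Nat.ListAction using (sum)
import Data.Nat.Tactic.RingSolver as ℕ-Solver
open import Data.Integer as ℤ using (ℤ; +_; _-_)
open import Data.Integer.Properties using (pos-+; pos-*)
import Data.Integer.Tactic.RingSolver as ℤ-Solver
open import Data.Bool using (Bool; true; false; _∧_; not; T)
open import Data.Bool.Properties using (T-∧; T-∨; ∧-comm; ∧-zeroʳ)
open import Data.Fin using (Fin; zero; suc; toℕ; fromℕ; fromℕ<; inject₁)
open import Data.Fin.Properties using (toℕ-injective; toℕ-fromℕ<; toℕ-fromℕ; toℕ-inject₁; toℕ<n)
open import Data.List using (List; []; _∷_; _++_; filter; length; allFin; applyUpTo)
open import Data.List.Properties using (filter-++; length-++; filter-≐; ++-identityʳ; map-upTo)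
import Data.List as List
open import Data.List.Relation.Unary.All using (All; []; _∷_)
open import Data.List.Relation.Unary.All.Properties using (tabulate⁺; tabulate⁻)
open import Data.Vec using (Vec; []; _∷_; _∷ʳ_; lookup; map)
open import Data.Vec.Properties using (lookup-map)
open import Data.Sum using (_⊎_; inj₁; inj₂)
open import Data.Product using (Σ; _×_; _,_; proj₁; proj₂)
open import Data.Empty using (⊥-elim)
open import Function using (_∘_; _⇔_; mk⇔; Equivalence)
open import Relation.Nullary.Decidable using (T?)
open import Relation.Binary.PropositionalEquality
  using (_≡_; _≗_; refl; sym; trans; cong; cong₂; subst; module ≡-Reasoning)

open Equivalence using (to; from)

-- Polynomials in x and y with natural coefficients: f j l is the coefficient of x^j y^l.
Poly : Set
Poly = ℕ → ℕ → ℕ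

infix  4 _≐_
infixl 6 _⊕_
infixr 7 x·_ y·_ z·_

_≐_ : Poly → Poly → Set
f ≐ g = ∀ j l → f j l ≡ g j l

_⊕_ : Poly → Poly → Poly
(f ⊕ g) j l = f j l + g j l

0ₚ 1ₚ : Poly
0ₚ _ _ = 0
1ₚ zero zero = 1
1ₚ _    _    = 0

x·_ y·_ z·_ : Poly → Poly
(x· f) zero    l = 0
(x· f) (suc j) l = f j l
(y· f) j zero    = 0
(y· f) j (suc l) = f j l
z· f = x· f ⊕ y· f

≐-sym : ∀ {f g} → f ≐ g → g ≐ f
≐-sym p j l = sym (p j l)

≐-trans : ∀ {f g h} → f ≐ g → g ≐ h → f ≐ h
≐-trans p q j l = trans (p j l) (q j l)

⊕-cong : ∀ {f f′ g g′} → f ≐ f′ → g ≐ g′ → f ⊕ g ≐ f′ ⊕ g′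
⊕-cong p q j l = cong₂ _+_ (p j l) (q j l)

⊕-congˡ : ∀ f {g g′} → g ≐ g′ → f ⊕ g ≐ f ⊕ g′
⊕-congˡ f p j l = cong (λ u → f j l + u) (p j l)

z·-cong : ∀ {f g} → f ≐ g → z· f ≐ z· g
z·-cong p zero    zero    = refl
z·-cong p zero    (suc l) = p zero l
z·-cong p (suc j) zero    = cong (_+ 0) (p j zero)
z·-cong p (suc j) (suc l) = cong₂ _+_ (p j (suc l)) (p (suc j) l)

x·-⊕ : ∀ f g → x· (f ⊕ g) ≐ x· f ⊕ x· g
x·-⊕ f g zero    l = refl
x·-⊕ f g (suc j) l = refl

y·-⊕ : ∀ f g → y· (f ⊕ g) ≐ y· f ⊕ y· g
y·-⊕ f g j zero    = refl
y·-⊕ f g j (suc l) = refl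

+-interchange : ∀ a b c d → (a + b) + (c + d) ≡ (a + c) + (b + d)
+-interchange = ℕ-Solver.solve-∀

z·-⊕ : ∀ f g → z· (f ⊕ g) ≐ z· f ⊕ z· g
z·-⊕ f g j l = trans (cong₂ _+_ (x·-⊕ f g j l) (y·-⊕ f g j l))
                     (+-interchange ((x· f) j l) ((x· g) j l) ((y· f) j l) ((y· g) j l))

z·-0ₚ : ∀ {f} → f ≐ 0ₚ → z· f ≐ 0ₚ
z·-0ₚ p j l = trans (z·-cong p j l) (z·0ₚ j l)
  where
  z·0ₚ : z· 0ₚ ≐ 0ₚ
  z·0ₚ zero    zero    = refl
  z·0ₚ zero    (suc l) = refl
  z·0ₚ (suc j) zero    = refl
  z·0ₚ (suc j) (suc l) = refl

Recurrent : (ℕ → Poly) → Set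
Recurrent S = ∀ k → S (suc (suc k)) ≐ S (suc k) ⊕ z· S k

Recurrent-⊕ : ∀ {S T} → Recurrent S → Recurrent T → Recurrent (λ k → S k ⊕ T k)
Recurrent-⊕ {S} {T} rS rT k j l = begin
  S (2 + k) j l + T (2 + k) j l
    ≡⟨ cong₂ _+_ (rS k j l) (rT k j l) ⟩
  (S (1 + k) j l + (z· S k) j l) + (T (1 + k) j l + (z· T k) j l)
    ≡⟨ +-interchange (S (1 + k) j l) _ (T (1 + k) j l) _ ⟩
  (S (1 + k) j l + T (1 + k) j l) + ((z· S k) j l + (z· T k) j l)
    ≡⟨ cong (λ u → S (1 + k) j l + T (1 + k) j l + u) (z·-⊕ (S k) (T k) j l) ⟨
  (S (1 + k) j l + T (1 + k) j l) + (z· (S k ⊕ T k)) j l ∎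
  where open ≡-Reasoning

Recurrent-z· : ∀ {S} → Recurrent S → Recurrent (λ k → z· S k)
Recurrent-z· {S} rS k = ≐-trans (z·-cong (rS k)) (z·-⊕ (S (suc k)) (z· S k))

Recurrent-unique : ∀ {S T} → Recurrent S → Recurrent T →
                   S 0 ≐ T 0 → S 1 ≐ T 1 → ∀ k → S k ≐ T k
Recurrent-unique {S} {T} rS rT e₀ e₁ k = proj₁ (consecutive k)
  where
  consecutive : ∀ k → S k ≐ T k × S (suc k) ≐ T (suc k)
  consecutive zero    = e₀ , e₁
  consecutive (suc k) =
    let eₖ , eₖ₊₁ = consecutive k
    in eₖ₊₁ , ≐-trans (rS k) (≐-trans (⊕-cong eₖ₊₁ (z·-cong eₖ)) (≐-sym (rT k)))

numerator : ℕ → Poly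
numerator 0 = 1ₚ
numerator 2 = z· 1ₚ
numerator _ = 0ₚ

-- For n ≥ 1, lucas n is the Lucas polynomial L_n(x + y).
lucas : ℕ → Poly
lucas 0             = numerator 0
lucas 1             = lucas 0
lucas (suc (suc n)) = lucas (suc n) ⊕ z· lucas n ⊕ numerator (suc (suc n))

Recurrent-lucas : Recurrent (λ k → lucas (2 + k))
Recurrent-lucas k j l = +-identityʳ _

numerator₁ : ℕ → ℕ
numerator₁ 0 = 1
numerator₁ 2 = 2
numerator₁ _ = 0

lucasTotal : ℕ → ℕ
lucasTotal 0             = 1
lucasTotal 1             = 1
lucasTotal (suc (suc n)) = lucasTotal (suc n) + 2 * lucasTotal n + numerator₁ (suc (suc n))

count : ∀ {A : Set} → (A → Bool) → List A → ℕ
count P xs = length (filter (λ x → T? (P x)) xs)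

count-++ : ∀ {A : Set} (P : A → Bool) xs ys → count P (xs ++ ys) ≡ count P xs + count P ys
count-++ P xs ys = trans (cong length (filter-++ (λ x → T? (P x)) xs ys)) (length-++ (filter _ xs))

count-map : ∀ {A B : Set} (P : B → Bool) (f : A → B) xs →
            count P (List.map f xs) ≡ count (P ∘ f) xs
count-map P f []       = refl
count-map P f (x ∷ xs) with P (f x)
... | true  = cong suc (count-map P f xs)
... | false = count-map P f xs

count-cong : ∀ {A : Set} {P Q : A → Bool} → P ≗ Q → ∀ xs → count P xs ≡ count Q xs
count-cong P≗Q xs =
  cong length (filter-≐ _ _ ((λ {x} → subst T (P≗Q x)) , (λ {x} → subst T (sym (P≗Q x)))) xs)

count-none : ∀ {A : Set} {P : A → Bool} → P ≗ (λ _ → false) → ∀ xs → count P xs ≡ 0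
count-none P≗false xs = trans (count-cong P≗false xs) (count-false xs)
  where
  count-false : ∀ xs → count (λ _ → false) xs ≡ 0
  count-false []       = refl
  count-false (x ∷ xs) = count-false xs

count-allColourings : ∀ {n} (P : Vec Colour (suc n) → Bool) →
  count P (allColourings (suc n)) ≡
  count (P ∘ (empty ∷_)) (allColourings n) +
  (count (P ∘ (blue ∷_)) (allColourings n) + count (P ∘ (red ∷_)) (allColourings n))
count-allColourings {n} P = begin
  count P (E ++ (B ++ (R ++ [])))      ≡⟨ cong (λ ds → count P (E ++ (B ++ ds))) (++-identityʳ R) ⟩
  count P (E ++ (B ++ R))              ≡⟨ count-++ P E (B ++ R) ⟩
  count P E + count P (B ++ R)         ≡⟨ cong (λ u → count P E + u) (count-++ P B R) ⟩
  count P E + (count P B + count P R)  ≡⟨ cong₂ _+_ (count-map P _ cs)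
                                                   (cong₂ _+_ (count-map P _ cs) (count-map P _ cs)) ⟩
  count (P ∘ (empty ∷_)) cs + (count (P ∘ (blue ∷_)) cs + count (P ∘ (red ∷_)) cs) ∎
  where
  open ≡-Reasoning
  cs = allColourings n
  E B R : List (Vec Colour (suc n))
  E = List.map (empty ∷_) cs
  B = List.map (blue ∷_) cs
  R = List.map (red ∷_) cs

profileOf : ∀ {n} → (Vec Colour n → Bool) → Poly
profileOf {n} P j l = count (λ c → P c ∧ (countB c ≡ᵇ j) ∧ (countR c ≡ᵇ l)) (allColourings n)

profileOf-cong : ∀ {n} {P Q : Vec Colour n → Bool} → P ≗ Q → profileOf P ≐ profileOf Q
profileOf-cong {n} P≗Q j l =
  count-cong (λ c → cong (_∧ ((countB c ≡ᵇ j) ∧ (countR c ≡ᵇ l))) (P≗Q c)) (allColourings n)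

profileOf-false : ∀ {n} → profileOf {n} (λ _ → false) ≐ 0ₚ
profileOf-false {n} j l = count-none (λ _ → refl) (allColourings n)

profileOf-∷ : ∀ {n} (P : Vec Colour (suc n) → Bool) →
  profileOf P ≐ profileOf (P ∘ (empty ∷_)) ⊕ (x· profileOf (P ∘ (blue ∷_)) ⊕ y· profileOf (P ∘ (red ∷_)))
profileOf-∷ {n} P j l =
  trans (count-allColourings (λ c → P c ∧ (countB c ≡ᵇ j) ∧ (countR c ≡ᵇ l)))
        (cong (λ u → profileOf (P ∘ (empty ∷_)) j l + u) (cong₂ _+_ (blue-first j) (red-first l)))
  where
  cs = allColourings n
  blue-first : ∀ j → count (λ c → P (blue ∷ c) ∧ (suc (countB c) ≡ᵇ j) ∧ (countR c ≡ᵇ l)) cs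
                     ≡ (x· profileOf (P ∘ (blue ∷_))) j l
  blue-first zero    = count-none (λ c → ∧-zeroʳ (P (blue ∷ c))) cs
  blue-first (suc j) = refl
  red-first : ∀ l → count (λ c → P (red ∷ c) ∧ (countB c ≡ᵇ j) ∧ (suc (countR c) ≡ᵇ l)) cs
                    ≡ (y· profileOf (P ∘ (red ∷_))) j l
  red-first zero    = count-none (λ c → trans (cong (P (red ∷ c) ∧_) (∧-zeroʳ _)) (∧-zeroʳ _)) cs
  red-first (suc l) = refl

T-⇔⇒≡ : ∀ {a b} → T a ⇔ T b → a ≡ b
T-⇔⇒≡ {false} {false} _   = refl
T-⇔⇒≡ {false} {true}  a⇔b = ⊥-elim (from a⇔b _)
T-⇔⇒≡ {true}  {false} a⇔b = ⊥-elim (to a⇔b _)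
T-⇔⇒≡ {true}  {true}  _   = refl

T-allB : ∀ {A : Set} (p : A → Bool) xs → T (allB p xs) ⇔ All (T ∘ p) xs
T-allB p []       = mk⇔ (λ _ → []) (λ _ → _)
T-allB p (x ∷ xs) = mk⇔ (λ h → let px , pxs = to T-∧ h in px ∷ to (T-allB p xs) pxs)
                        (λ { (px ∷ pxs) → from T-∧ (px , from (T-allB p xs) pxs) })

T-allB-allFin : ∀ {n} (p : Fin n → Bool) → T (allB p (allFin n)) ⇔ (∀ i → T (p i))
T-allB-allFin p = mk⇔ (tabulate⁻ ∘ to (T-allB p _)) (from (T-allB p _) ∘ tabulate⁺)

noAdjacent : ∀ {n} → Vec Bool n → Bool
noAdjacent []          = true
noAdjacent (a ∷ [])    = true
noAdjacent (a ∷ b ∷ u) = not (a ∧ b) ∧ noAdjacent (b ∷ u)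

NoAdjacentPair : ∀ {n} → Vec Bool (suc n) → Set
NoAdjacentPair u = ∀ i → T (not (lookup u (inject₁ i) ∧ lookup u (suc i)))

T-noAdjacent : ∀ {n} (u : Vec Bool (suc n)) → T (noAdjacent u) ⇔ NoAdjacentPair u
T-noAdjacent (a ∷ [])    = mk⇔ (λ _ ()) (λ _ → _)
T-noAdjacent (a ∷ b ∷ u) = mk⇔ forward backward
  where
  forward : T (noAdjacent (a ∷ b ∷ u)) → NoAdjacentPair (a ∷ b ∷ u)
  forward h zero    = proj₁ (to T-∧ h)
  forward h (suc i) = to (T-noAdjacent (b ∷ u)) (proj₂ (to T-∧ h)) i
  backward : NoAdjacentPair (a ∷ b ∷ u) → T (noAdjacent (a ∷ b ∷ u))
  backward h = from T-∧ (h zero , from (T-noAdjacent (b ∷ u)) (h ∘ suc))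

-- Positions on a path whose two outside neighbours are coloured iff p, respectively w.
isPathPosition : ∀ {n} → Bool → Bool → Vec Colour n → Bool
isPathPosition p w v = noAdjacent (p ∷ (map coloured v ∷ʳ w))

isCyclePosition : ∀ {n} → Vec Colour (suc n) → Bool
isCyclePosition (x ∷ xs) = isPathPosition (coloured x) (coloured x) xs

next : ∀ {m} → Fin (suc m) → Fin (suc m)
next {m} i = fromℕ< (m%n<n (toℕ i + 1) (suc m))

adjacent-next : ∀ {m} (i : Fin (suc m)) → T (adjacent (suc m) i (next i))
adjacent-next {m} i = from T-∨ (inj₁ (≡⇒≡ᵇ _ _ (toℕ-fromℕ< (m%n<n (toℕ i + 1) (suc m)))))

adjacent⇒next : ∀ {m} (i j : Fin (suc m)) → T (adjacent (suc m) i j) → j ≡ next i ⊎ i ≡ next j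
adjacent⇒next {m} i j adj with to T-∨ adj
... | inj₁ j≡i+1 = inj₁ (toℕ-injective (trans (≡ᵇ⇒≡ _ _ j≡i+1) (sym (toℕ-fromℕ< _))))
... | inj₂ i≡j+1 = inj₂ (toℕ-injective (trans (≡ᵇ⇒≡ _ _ i≡j+1) (sym (toℕ-fromℕ< _))))

next-fromℕ : ∀ m → next (fromℕ m) ≡ zero
next-fromℕ m = toℕ-injective (begin
  toℕ (next (fromℕ m))         ≡⟨ toℕ-fromℕ< _ ⟩
  (toℕ (fromℕ m) + 1) % suc m  ≡⟨ cong (λ k → (k + 1) % suc m) (toℕ-fromℕ m) ⟩
  (m + 1) % suc m              ≡⟨ cong (_% suc m) (+-comm m 1) ⟩
  suc m % suc m                ≡⟨ n%n≡0 (suc m) ⟩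
  0                            ∎)
  where open ≡-Reasoning

next-inject₁ : ∀ {m} (i : Fin m) → next (inject₁ i) ≡ suc i
next-inject₁ {m} i = toℕ-injective (begin
  toℕ (next (inject₁ i))         ≡⟨ toℕ-fromℕ< _ ⟩
  (toℕ (inject₁ i) + 1) % suc m  ≡⟨ cong (λ k → (k + 1) % suc m) (toℕ-inject₁ i) ⟩
  (toℕ i + 1) % suc m            ≡⟨ cong (_% suc m) (+-comm (toℕ i) 1) ⟩
  suc (toℕ i) % suc m            ≡⟨ m<n⇒m%n≡m (s≤s (toℕ<n i)) ⟩
  suc (toℕ i)                    ∎)
  where open ≡-Reasoning

fromℕ-or-inject₁ : ∀ {m} (i : Fin (suc m)) → i ≡ fromℕ m ⊎ Σ (Fin m) (λ k → i ≡ inject₁ k)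
fromℕ-or-inject₁ {zero}  zero    = inj₁ refl
fromℕ-or-inject₁ {suc m} zero    = inj₂ (zero , refl)
fromℕ-or-inject₁ {suc m} (suc i) with fromℕ-or-inject₁ i
... | inj₁ refl      = inj₁ refl
... | inj₂ (k , refl) = inj₂ (suc k , refl)

lookup-∷ʳ-fromℕ : ∀ {A : Set} {m} (xs : Vec A m) y → lookup (xs ∷ʳ y) (fromℕ m) ≡ y
lookup-∷ʳ-fromℕ []       y = refl
lookup-∷ʳ-fromℕ (x ∷ xs) y = lookup-∷ʳ-fromℕ xs y

lookup-∷ʳ-inject₁ : ∀ {A : Set} {m} (xs : Vec A m) y i → lookup (xs ∷ʳ y) (inject₁ i) ≡ lookup xs i
lookup-∷ʳ-inject₁ (x ∷ xs) y zero    = refl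
lookup-∷ʳ-inject₁ (x ∷ xs) y (suc i) = lookup-∷ʳ-inject₁ xs y i

lookup-∷ʳ-next : ∀ {A : Set} {m} (y : A) (xs : Vec A m) i →
                 lookup (xs ∷ʳ y) i ≡ lookup (y ∷ xs) (next i)
lookup-∷ʳ-next {m = m} y xs i with fromℕ-or-inject₁ i
... | inj₁ refl       = trans (lookup-∷ʳ-fromℕ xs y) (cong (lookup (y ∷ xs)) (sym (next-fromℕ m)))
... | inj₂ (k , refl) = trans (lookup-∷ʳ-inject₁ xs y k) (cong (lookup (y ∷ xs)) (sym (next-inject₁ k)))

col : ∀ {n} → Vec Colour n → Fin n → Bool
col c i = coloured (lookup c i)

NoColouredNeighbours : ∀ {m} → Vec Colour (suc m) → Set
NoColouredNeighbours c = ∀ i → T (not (col c i ∧ col c (next i)))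

T-not-∧-elim : ∀ {a b} → T a → T (not (a ∧ b)) → T (not b)
T-not-∧-elim {true} _ h = h

T-not-∧-intro : ∀ {a b} → (T a → T (not b)) → T (not (a ∧ b))
T-not-∧-intro {false} _ = _
T-not-∧-intro {true}  h = h _

T-isCisPosition : ∀ {m} (c : Vec Colour (suc m)) →
                  T (isCisPosition (suc m) c) ⇔ NoColouredNeighbours c
T-isCisPosition c = mk⇔ forward backward
  where
  forward : T (isCisPosition _ c) → NoColouredNeighbours c
  forward h i =
    T-not-∧-elim (adjacent-next i) (to (T-allB-allFin _) (to (T-allB-allFin _) h i) (next i))
  edge : ∀ {i j} → NoColouredNeighbours c →
         j ≡ next i ⊎ i ≡ next j → T (not (col c i ∧ col c j))
  edge h (inj₁ refl) = h _
  edge h (inj₂ refl) = subst (T ∘ not) (∧-comm (col c _) (col c _)) (h _)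
  backward : NoColouredNeighbours c → T (isCisPosition _ c)
  backward h = from (T-allB-allFin _) λ i → from (T-allB-allFin _) λ j →
               T-not-∧-intro (edge h ∘ adjacent⇒next i j)

T-isCyclePosition : ∀ {m} (c : Vec Colour (suc m)) →
                    T (isCyclePosition c) ⇔ NoColouredNeighbours c
T-isCyclePosition c@(x ∷ xs) = mk⇔
  (λ h i → subst (T ∘ not) (pair i) (to (T-noAdjacent u) h i))
  (λ h → from (T-noAdjacent u) (λ i → subst (T ∘ not) (sym (pair i)) (h i)))
  where
  u : Vec Bool _
  u = map coloured c ∷ʳ coloured x
  pair : ∀ i → (lookup u (inject₁ i) ∧ lookup u (suc i)) ≡ (col c i ∧ col c (next i))
  pair i = cong₂ _∧_ (trans (lookup-∷ʳ-inject₁ (map coloured c) _ i) (lookup-map i coloured c))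
                     (trans (lookup-∷ʳ-next _ (map coloured xs) i) (lookup-map (next i) coloured c))

isCisPosition≡isCyclePosition : ∀ {m} (c : Vec Colour (suc m)) →
                                isCisPosition (suc m) c ≡ isCyclePosition c
isCisPosition≡isCyclePosition c =
  T-⇔⇒≡ (mk⇔ (from (T-isCyclePosition c) ∘ to (T-isCisPosition c))
             (from (T-isCisPosition c) ∘ to (T-isCyclePosition c)))

pathProfile : Bool → Bool → ℕ → Poly
pathProfile p w n = profileOf (isPathPosition {n} p w)

pathProfile-suc-false : ∀ w n →
  pathProfile false w (suc n) ≐ pathProfile false w n ⊕ z· pathProfile true w n
pathProfile-suc-false w n = profileOf-∷ (isPathPosition {suc n} false w)

pathProfile-suc-true : ∀ w n → pathProfile true w (suc n) ≐ pathProfile false w n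
pathProfile-suc-true w n j l =
  trans (profileOf-∷ (isPathPosition {suc n} true w) j l)
        (trans (cong (λ u → pathProfile false w n j l + u) (z·-0ₚ (profileOf-false {n}) j l))
               (+-identityʳ _))

Recurrent-pathProfile : ∀ w → Recurrent (pathProfile false w)
Recurrent-pathProfile w n =
  ≐-trans (pathProfile-suc-false w (suc n))
          (⊕-congˡ (pathProfile false w (suc n)) (z·-cong (pathProfile-suc-true w n)))

profile-suc : ∀ n → profile (suc n) ≐ pathProfile false false n ⊕ z· pathProfile true true n
profile-suc n =
  ≐-trans (profileOf-cong (isCisPosition≡isCyclePosition {n})) (profileOf-∷ (isCyclePosition {n}))

cycleProfile : ℕ → Poly
cycleProfile n = pathProfile false false (suc n) ⊕ z· pathProfile false true n

profile≐cycleProfile : ∀ n → profile (2 + n) ≐ cycleProfile n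
profile≐cycleProfile n =
  ≐-trans (profile-suc (suc n))
          (⊕-congˡ (pathProfile false false (suc n)) (z·-cong (pathProfile-suc-true true n)))

Recurrent-cycleProfile : Recurrent cycleProfile
Recurrent-cycleProfile =
  Recurrent-⊕ {λ n → pathProfile false false (suc n)} {λ n → z· pathProfile false true n}
              (λ n → Recurrent-pathProfile false (suc n)) (Recurrent-z· (Recurrent-pathProfile true))

-- By evaluation: both sides are 1 + 2(x + y), respectively 1 + 3(x + y).
cycleProfile₀ : cycleProfile 0 ≐ lucas 2
cycleProfile₀ zero          zero          = refl
cycleProfile₀ zero          (suc zero)    = refl
cycleProfile₀ zero          (suc (suc l)) = refl
cycleProfile₀ (suc zero)    zero          = refl
cycleProfile₀ (suc zero)    (suc l)       = refl
cycleProfile₀ (suc (suc j)) zero          = refl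
cycleProfile₀ (suc (suc j)) (suc l)       = refl

cycleProfile₁ : cycleProfile 1 ≐ lucas 3
cycleProfile₁ zero          zero          = refl
cycleProfile₁ zero          (suc zero)    = refl
cycleProfile₁ zero          (suc (suc l)) = refl
cycleProfile₁ (suc zero)    zero          = refl
cycleProfile₁ (suc zero)    (suc l)       = refl
cycleProfile₁ (suc (suc j)) zero          = refl
cycleProfile₁ (suc (suc j)) (suc l)       = refl

profile≐lucas : ∀ {n} → n ≥ 2 → profile n ≐ lucas n
profile≐lucas {suc (suc n)} (s≤s (s≤s _)) = ≐-trans (profile≐cycleProfile n)
  (Recurrent-unique {cycleProfile} {λ k → lucas (2 + k)}
                    Recurrent-cycleProfile Recurrent-lucas cycleProfile₀ cycleProfile₁ n)

sumBelow : ℕ → (ℕ → ℕ) → ℕ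
sumBelow n f = sum (applyUpTo f n)

sumBelow-cong : ∀ n {f g} → f ≗ g → sumBelow n f ≡ sumBelow n g
sumBelow-cong zero    f≗g = refl
sumBelow-cong (suc n) f≗g = cong₂ _+_ (f≗g 0) (sumBelow-cong n (λ i → f≗g (suc i)))

sumBelow-+ : ∀ n f g → sumBelow n (λ i → f i + g i) ≡ sumBelow n f + sumBelow n g
sumBelow-+ zero    f g = refl
sumBelow-+ (suc n) f g =
  trans (cong (λ s → f 0 + g 0 + s) (sumBelow-+ n (λ i → f (suc i)) (λ i → g (suc i))))
        (+-interchange (f 0) (g 0) _ _)

sumBelow-zero : ∀ n {f} → f ≗ (λ _ → 0) → sumBelow n f ≡ 0
sumBelow-zero n f≗0 = trans (sumBelow-cong n f≗0) (zeros n)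
  where
  zeros : ∀ n → sumBelow n (λ _ → 0) ≡ 0
  zeros zero    = refl
  zeros (suc n) = zeros n

total : ℕ → ℕ → Poly → ℕ
total a b f = sumBelow a (λ j → sumBelow b (f j))

total-cong : ∀ a b {f g} → f ≐ g → total a b f ≡ total a b g
total-cong a b f≐g = sumBelow-cong a (λ j → sumBelow-cong b (f≐g j))

total-⊕ : ∀ a b f g → total a b (f ⊕ g) ≡ total a b f + total a b g
total-⊕ a b f g = trans (sumBelow-cong a (λ j → sumBelow-+ b (f j) (g j))) (sumBelow-+ a _ _)

total-0ₚ : ∀ a b → total a b 0ₚ ≡ 0
total-0ₚ a b = sumBelow-zero a (λ _ → sumBelow-zero b (λ _ → refl))

total-1ₚ : ∀ a b → total (suc a) (suc b) 1ₚ ≡ 1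
total-1ₚ a b = cong₂ _+_ (cong suc (sumBelow-zero b (λ _ → refl)))
                         (sumBelow-zero a (λ _ → sumBelow-zero (suc b) (λ _ → refl)))

total-x· : ∀ a b f → total (suc a) b (x· f) ≡ total a b f
total-x· a b f = cong (_+ total a b f) (sumBelow-zero b (λ _ → refl))

total-z· : ∀ a b f → total (suc a) (suc b) (z· f) ≡ total a (suc b) f + total (suc a) b f
total-z· a b f =
  trans (total-⊕ (suc a) (suc b) (x· f) (y· f)) (cong (_+ total (suc a) b f) (total-x· a (suc b) f))

total-numerator : ∀ n a b → n < a → n < b → total a b (numerator n) ≡ numerator₁ n
total-numerator 0 (suc a) (suc b) _ _ = total-1ₚ a b
total-numerator 1 a b _ _ = total-0ₚ a b
total-numerator 2 (suc (suc (suc a))) (suc (suc (suc b))) (s≤s (s≤s (s≤s _))) (s≤s (s≤s (s≤s _))) =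
  trans (total-z· (suc (suc a)) (suc (suc b)) 1ₚ)
        (cong₂ _+_ (total-1ₚ (suc a) (suc (suc b))) (total-1ₚ (suc (suc a)) (suc b)))
total-numerator (suc (suc (suc n))) a b _ _ = total-0ₚ a b

-- Quantifying over every box that strictly contains the degrees of lucas n (and hence its
-- support) is what lets the induction use a smaller box for the shifted terms.
total-lucas : ∀ n a b → n < a → n < b → total a b (lucas n) ≡ lucasTotal n
total-lucas 0 (suc a) (suc b) _ _ = total-1ₚ a b
total-lucas 1 (suc a) (suc b) _ _ = total-1ₚ a b
total-lucas (suc (suc m)) (suc a) (suc b) p@(s≤s m+1<a) q@(s≤s m+1<b) = begin
  total (suc a) (suc b) (lucas (suc m) ⊕ z· lucas m ⊕ numerator (suc (suc m)))
    ≡⟨ total-⊕ (suc a) (suc b) (lucas (suc m) ⊕ z· lucas m) (numerator (suc (suc m))) ⟩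
  total (suc a) (suc b) (lucas (suc m) ⊕ z· lucas m) + total (suc a) (suc b) (numerator (suc (suc m)))
    ≡⟨ cong₂ _+_ (total-⊕ (suc a) (suc b) (lucas (suc m)) (z· lucas m))
                 (total-numerator (suc (suc m)) _ _ p q) ⟩
  total (suc a) (suc b) (lucas (suc m)) + total (suc a) (suc b) (z· lucas m) + numerator₁ (suc (suc m))
    ≡⟨ cong (_+ numerator₁ (suc (suc m)))
            (cong₂ _+_ (total-lucas (suc m) _ _ (m<n⇒m<1+n m+1<a) (m<n⇒m<1+n m+1<b))
                       (total-z· a b (lucas m))) ⟩
  lucasTotal (suc m) + (total a (suc b) (lucas m) + total (suc a) b (lucas m)) + numerator₁ (suc (suc m))
    ≡⟨ cong (λ u → lucasTotal (suc m) + u + numerator₁ (suc (suc m)))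
            (cong₂ _+_ (total-lucas m _ _ (<⇒≤ m+1<a) (m<n⇒m<1+n (<⇒≤ m+1<b)))
                       (trans (total-lucas m _ _ (m<n⇒m<1+n (<⇒≤ m+1<a)) (<⇒≤ m+1<b))
                              (sym (+-identityʳ _)))) ⟩
  lucasTotal (suc (suc m)) ∎
  where open ≡-Reasoning

profileAt11≡total : ∀ n → profileAt11 n ≡ total (suc n) (suc n) (profile n)
profileAt11≡total n =
  trans (cong sum (map-upTo _ (suc n)))
        (sumBelow-cong (suc n) (λ j → cong sum (map-upTo (profile n j) (suc n))))

numer≡numerator : ∀ n j l → numer n j l ≡ + numerator n j l
numer≡numerator 0 0       0             = refl
numer≡numerator 0 0       (suc l)       = refl
numer≡numerator 0 (suc j) l             = refl
numer≡numerator 1 j       l             = refl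
numer≡numerator 2 0       0             = refl
numer≡numerator 2 0       1             = refl
numer≡numerator 2 0       (suc (suc l)) = refl
numer≡numerator 2 1       0             = refl
numer≡numerator 2 1       (suc l)       = refl
numer≡numerator 2 (suc (suc j)) 0       = refl
numer≡numerator 2 (suc (suc j)) (suc l) = refl
numer≡numerator (suc (suc (suc n))) j l = refl

numer1≡numerator₁ : ∀ n → numer1 n ≡ + numerator₁ n
numer1≡numerator₁ 0                   = refl
numer1≡numerator₁ 1                   = refl
numer1≡numerator₁ 2                   = refl
numer1≡numerator₁ (suc (suc (suc n))) = refl

pos-+₄ : ∀ a b c d → + (a + (b + c) + d) ≡ + a ℤ.+ (+ b ℤ.+ + c) ℤ.+ + d
pos-+₄ a b c d
  rewrite pos-+ (a + (b + c)) d | pos-+ a (b + c) | pos-+ b c = refl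

pos-+-2* : ∀ a b c → + (a + 2 * b + c) ≡ + a ℤ.+ + 2 ℤ.* + b ℤ.+ + c
pos-+-2* a b c =
  trans (pos-+ (a + 2 * b) c)
        (cong (λ u → u ℤ.+ + c) (trans (pos-+ a (2 * b)) (cong (λ u → + a ℤ.+ u) (pos-* 2 b))))

leading-term-⇔ : ∀ a b c d e → a - b - c - d ≡ e ⇔ a ≡ b ℤ.+ (c ℤ.+ d) ℤ.+ e
leading-term-⇔ a b c d e = mk⇔
  (λ eq → trans (expand a b c d) (cong (λ u → b ℤ.+ (c ℤ.+ d) ℤ.+ u) eq))
  (λ eq → trans (cong (λ u → u - b - c - d) eq) (cancel b c d e))
  where
  expand : ∀ a b c d → a ≡ b ℤ.+ (c ℤ.+ d) ℤ.+ (a - b - c - d)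
  expand = ℤ-Solver.solve-∀
  cancel : ∀ b c d e → b ℤ.+ (c ℤ.+ d) ℤ.+ e - b - c - d ≡ e
  cancel = ℤ-Solver.solve-∀

leading-term₁-⇔ : ∀ a b c e → a - b - + 2 ℤ.* c ≡ e ⇔ a ≡ b ℤ.+ + 2 ℤ.* c ℤ.+ e
leading-term₁-⇔ a b c e = mk⇔
  (λ eq → trans (expand a b c) (cong (λ u → b ℤ.+ + 2 ℤ.* c ℤ.+ u) eq))
  (λ eq → trans (cong (λ u → u - b - + 2 ℤ.* c) eq) (cancel b c e))
  where
  expand : ∀ a b c → a ≡ b ℤ.+ + 2 ℤ.* c ℤ.+ (a - b - + 2 ℤ.* c)
  expand = ℤ-Solver.solve-∀
  cancel : ∀ b c e → b ℤ.+ + 2 ℤ.* c ℤ.+ e - b - + 2 ℤ.* c ≡ e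
  cancel = ℤ-Solver.solve-∀

lucas-coefficient : ∀ m j l →
  + lucas (2 + m) j l - + lucas (1 + m) j l - + (x· lucas m) j l - + (y· lucas m) j l
  ≡ + numerator (2 + m) j l
lucas-coefficient m j l = from (leading-term-⇔ _ (+ a) (+ b) (+ c) (+ d)) (pos-+₄ a b c d)
  where
  a = lucas (suc m) j l
  b = (x· lucas m) j l
  c = (y· lucas m) j l
  d = numerator (2 + m) j l

-- denomTimes only unfolds once j and l are split into zero and suc.
lucas-isQuotient : IsQuotient3 (λ n j l → + lucas n j l)
lucas-isQuotient 0             j       l       =
  trans (cancel (+ lucas 0 j l)) (sym (numer≡numerator 0 j l))
  where
  cancel : ∀ a → a - + 0 - + 0 - + 0 ≡ a
  cancel = ℤ-Solver.solve-∀
lucas-isQuotient 1             j       l       = cancel (+ lucas 0 j l)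
  where
  cancel : ∀ a → a - a - + 0 - + 0 ≡ + 0
  cancel = ℤ-Solver.solve-∀
lucas-isQuotient (suc (suc m)) zero    zero    = trans (lucas-coefficient m _ _) (sym (numer≡numerator _ _ _))
lucas-isQuotient (suc (suc m)) zero    (suc l) = trans (lucas-coefficient m _ _) (sym (numer≡numerator _ _ _))
lucas-isQuotient (suc (suc m)) (suc j) zero    = trans (lucas-coefficient m _ _) (sym (numer≡numerator _ _ _))
lucas-isQuotient (suc (suc m)) (suc j) (suc l) = trans (lucas-coefficient m _ _) (sym (numer≡numerator _ _ _))

isQuotient3⇒lucas : ∀ Q → IsQuotient3 Q → ∀ n j l → Q n j l ≡ + lucas n j l
isQuotient3⇒lucas Q isQ n = proj₁ (consecutive n)
  where
  Agrees : ℕ → Set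
  Agrees n = ∀ j l → Q n j l ≡ + lucas n j l

  isQ′ : ∀ n j l → denomTimes Q n j l ≡ + numerator n j l
  isQ′ n j l = trans (isQ n j l) (numer≡numerator n j l)

  leading : ∀ {a b c d : ℤ} b′ c′ d′ {e′} → a - b - c - d ≡ + e′ →
            b ≡ + b′ → c ≡ + c′ → d ≡ + d′ → a ≡ + (b′ + (c′ + d′) + e′)
  leading b′ c′ d′ {e′} eq refl refl refl =
    trans (to (leading-term-⇔ _ _ _ _ _) eq) (sym (pos-+₄ b′ c′ d′ e′))

  step : ∀ m → Agrees m → Agrees (suc m) → Agrees (suc (suc m))
  step m eₘ eₘ₊₁ zero    zero    = leading _ 0 0 (isQ′ _ _ _) (eₘ₊₁ _ _) refl     refl
  step m eₘ eₘ₊₁ zero    (suc l) = leading _ 0 _ (isQ′ _ _ _) (eₘ₊₁ _ _) refl     (eₘ _ _)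
  step m eₘ eₘ₊₁ (suc j) zero    = leading _ _ 0 (isQ′ _ _ _) (eₘ₊₁ _ _) (eₘ _ _) refl
  step m eₘ eₘ₊₁ (suc j) (suc l) = leading _ _ _ (isQ′ _ _ _) (eₘ₊₁ _ _) (eₘ _ _) (eₘ _ _)

  consecutive : ∀ n → Agrees n × Agrees (suc n)
  consecutive zero    = e₀ , e₁
    where
    e₀ : Agrees 0
    e₀ j l = leading 0 0 0 (isQ′ 0 j l) refl refl refl
    e₁ : Agrees 1
    e₁ j l = trans (leading _ 0 0 (isQ′ 1 j l) (e₀ j l) refl refl)
                   (cong +_ (trans (+-identityʳ _) (+-identityʳ _)))
  consecutive (suc n) = let eₙ , eₙ₊₁ = consecutive n in eₙ₊₁ , step n eₙ eₙ₊₁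

lucasTotal-isQuotient : IsQuotient1 (λ n → + lucasTotal n)
lucasTotal-isQuotient 0             = refl
lucasTotal-isQuotient 1             = refl
lucasTotal-isQuotient (suc (suc m)) =
  trans (from (leading-term₁-⇔ _ (+ a) (+ b) (+ c)) (pos-+-2* a b c)) (sym (numer1≡numerator₁ (2 + m)))
  where
  a = lucasTotal (suc m)
  b = lucasTotal m
  c = numerator₁ (2 + m)

isQuotient1⇒lucasTotal : ∀ R → IsQuotient1 R → ∀ n → R n ≡ + lucasTotal n
isQuotient1⇒lucasTotal R isR n = proj₁ (consecutive n)
  where
  leading : ∀ {a b c : ℤ} b′ c′ {e′} → a - b - + 2 ℤ.* c ≡ + e′ →
            b ≡ + b′ → c ≡ + c′ → a ≡ + (b′ + 2 * c′ + e′)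
  leading b′ c′ {e′} eq refl refl =
    trans (to (leading-term₁-⇔ _ (+ b′) (+ c′) _) eq) (sym (pos-+-2* b′ c′ e′))

  consecutive : ∀ n → R n ≡ + lucasTotal n × R (suc n) ≡ + lucasTotal (suc n)
  consecutive zero    = isR 0 , trans (expand (R 1) (R 0)) (cong₂ ℤ._+_ (isR 1) (isR 0))
    where
    expand : ∀ a b → a ≡ (a - b) ℤ.+ b
    expand = ℤ-Solver.solve-∀
  consecutive (suc n) =
    let eₙ , eₙ₊₁ = consecutive n
    in eₙ₊₁ , leading _ _ (trans (isR (2 + n)) (numer1≡numerator₁ (2 + n))) eₙ₊₁ eₙ

profileAt11≡lucasTotal : ∀ {n} → n ≥ 2 → profileAt11 n ≡ lucasTotal n
profileAt11≡lucasTotal {n} n≥2 = begin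
  profileAt11 n                      ≡⟨ profileAt11≡total n ⟩
  total (suc n) (suc n) (profile n)  ≡⟨ total-cong (suc n) (suc n) (profile≐lucas n≥2) ⟩
  total (suc n) (suc n) (lucas n)    ≡⟨ total-lucas n (suc n) (suc n) (n<1+n n) (n<1+n n) ⟩
  lucasTotal n                       ∎
  where open ≡-Reasoning

mainTheorem7 : (Σ Series3 IsQuotient3 × Σ Series1 IsQuotient1)
               × ((Q : Series3) → IsQuotient3 Q →
                    (n : ℕ) → n ≥ 3 → (j l : ℕ) → Q n j l ≡ + profile n j l)
               × ((R : Series1) → IsQuotient1 R →
                    (n : ℕ) → n ≥ 3 → R n ≡ + profileAt11 n)
mainTheorem7 =
  ( ((λ n j l → + lucas n j l) , lucas-isQuotient)
  , ((λ n → + lucasTotal n) , lucasTotal-isQuotient) )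
  , (λ Q isQ n n≥3 j l →
       trans (isQuotient3⇒lucas Q isQ n j l) (cong +_ (sym (profile≐lucas (<⇒≤ n≥3) j l))))
  , (λ R isR n n≥3 →
       trans (isQuotient1⇒lucasTotal R isR n) (cong +_ (sym (profileAt11≡lucasTotal (<⇒≤ n≥3)))))
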